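{- If $G_1,\dots,G_t$ are totally-ordered $k$-uniform pographs, then \[\operatorname{BR}^k(G_1,\dots,G_t) = \operatorname{CR}^k(G_1,\dots,G_t)- 1 = \operatorname{OR}^k(G_1,\dots,G_t)-1.\]
   Context: A $k$-chain in a poset is a set of $k$ distinct pairwise comparable elements. A $k$-uniform pograph $H$ is a poset $(V(H),\le)$ with a set $E(H)$ of edges, each a $k$-chain; it is totally-ordered if its poset is a chain (so it is a $k$-uniform ordered hypergraph). Given a coloring of the $k$-chains of a poset $Q$, a copy of $H$ in color $i$ is an injection $f:V(H)\to Q$ with $f(x)\le f(y)$ whenever $x\le y$, such that $f(e)$ has color $i$ for every $e\in E(H)$. $\operatorname{CR}^k(G_1,\dots,G_t)$ (resp. $\operatorname{BR}^k$) is the least $N$ such that every coloring of the $k$-chains of the $N$-element chain $C_N$ (resp. of the Boolean lattice $B_N$ of subsets of $[N]$) with colors $\{1,\dots,t\}$ contains, for some $i$, a copy of $G_i$ in color $i$. The ordered Ramsey number $\operatorname{OR}^k(G_1,\dots,G_t)$ of ordered hypergraphs is the least $N$ such that every $t$-coloring of the edges of the complete $k$-uniform hypergraph on $\{1,\dots,N\}$ contains, for some $i$, an order-preserving copy of $G_i$ in color $i$. -}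

module Defs where

open import Level using (0ℓ)
open import Data.Nat using (ℕ; _≤_)
open import Data.Fin using (Fin) renaming (_<_ to _<ᶠ_; _≤_ to _≤ᶠ_)
open import Data.Fin.Subset using (Subset; _⊆_; ∣_∣; ⁅_⁆; _∪_; ⊥)
open import Data.Vec using (Vec; lookup; map; foldr′)
open import Data.List using (List)
open import Data.List.Membership.Propositional using (_∈_)
open import Data.Product using (Σ; ∃-syntax; _×_)
open import Relation.Binary.Core using (Rel)
open import Relation.Binary.Definitions using (Total)
open import Relation.Binary.Structures using (IsPartialOrder)
open import Relation.Binary.PropositionalEquality using (_≡_)
open import Relation.Nullary using (¬_)
open import Function.Definitions using (Injective)

-- Chains in a poset (A, ≤).  A k-chain {x₁ < … < x_k} is represented by
-- its (unique) increasing enumeration, a vector of length k.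

Strict : {A : Set} → Rel A 0ℓ → Rel A 0ℓ
Strict _≤'_ x y = x ≤' y × ¬ (x ≡ y)

IsChain : {A : Set} (_≤'_ : Rel A 0ℓ) {k : ℕ} → Vec A k → Set
IsChain _≤'_ {k} v =
  ∀ (i j : Fin k) → i <ᶠ j → Strict _≤'_ (lookup v i) (lookup v j)

record KChain {A : Set} (_≤'_ : Rel A 0ℓ) (k : ℕ) : Set where
  constructor chain
  field
    elems : Vec A k
    .isChain : IsChain _≤'_ elems

record Pograph (k : ℕ) : Set₁ where
  field
    n : ℕ
    _≼_ : Rel (Fin n) 0ℓ
    isPartialOrder : IsPartialOrder _≡_ _≼_
    edges : List (Vec (Fin n) k)
    edgesAreChains : ∀ {e} → e ∈ edges → IsChain _≼_ e

TotallyOrdered : ∀ {k} → Pograph k → Set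
TotallyOrdered H = Total (Pograph._≼_ H)

HasCopy : ∀ {k t} {A : Set} (_≤'_ : Rel A 0ℓ) →
          (KChain _≤'_ k → Fin t) → Pograph k → Fin t → Set
HasCopy {A = A} _≤'_ c H i =
  Σ (Fin n → A) λ f →
      Injective _≡_ _≡_ f
    × (∀ x y → x ≼ y → f x ≤' f y)
    × (∀ {e} → e ∈ edges → (p : IsChain _≤'_ (map f e)) →
         c (chain (map f e) p) ≡ i)
  where open Pograph H

RamseyFor : ∀ {k t} {A : Set} (_≤'_ : Rel A 0ℓ) → (Fin t → Pograph k) → Set
RamseyFor {k} {t} _≤'_ G =
  ∀ (c : KChain _≤'_ k → Fin t) → ∃[ i ] HasCopy _≤'_ c (G i) i

CRProp : ∀ {k t} → (Fin t → Pograph k) → ℕ → Set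
CRProp G N = RamseyFor {A = Fin N} _≤ᶠ_ G

BRProp : ∀ {k t} → (Fin t → Pograph k) → ℕ → Set
BRProp G N = RamseyFor {A = Subset N} _⊆_ G

record KSubset (N k : ℕ) : Set where
  constructor ksubset
  field
    set : Subset N
    .card : ∣ set ∣ ≡ k

image : ∀ {N k} → Vec (Fin N) k → Subset N
image = foldr′ (λ x s → ⁅ x ⁆ ∪ s) ⊥

HasOrderedCopy : ∀ {k t N} → (KSubset N k → Fin t) → Pograph k → Fin t → Set
HasOrderedCopy {N = N} c H i =
  Σ (Fin n → Fin N) λ f →
      (∀ x y → Strict _≼_ x y → f x <ᶠ f y)
    × (∀ {e} → e ∈ edges → (p : ∣ image (map f e) ∣ ≡ _) →
         c (ksubset (image (map f e)) p) ≡ i)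
  where open Pograph H

ORProp : ∀ {k t} → (Fin t → Pograph k) → ℕ → Set
ORProp {k} {t} G N =
  ∀ (c : KSubset N k → Fin t) → ∃[ i ] HasOrderedCopy c (G i) i

IsLeast : (ℕ → Set) → ℕ → Set
IsLeast P N = P N × (∀ M → P M → N ≤ M)

-- Ranking its vertices turns a totally ordered pograph into an ordered hypergraph, and its copies
-- in a poset become the maps preserving the strict order under which every edge gets the given
-- colour.  Such copies compose with any map between posets that preserves the strict order, so the
-- Ramsey property transfers along the inclusions C_m → C_m' (m ≤ m'), along
-- j ↦ {0,…,j−1} : C_{N+1} → B_N and along the cardinality map B_N → C_{N+1}; hence BR = CR − 1.
-- The k-chains of C_N are the increasing enumerations of the k-subsets of [N], whence CR = OR.
-- Finally CR is finite by the ordered Ramsey theorem, proved by induction on k and on Σ aᵢ through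
-- the link of the least vertex, and CRProp is decidable, so a least witness exists.

module Submission where

open import Defs
open import Level using (0ℓ)
open import Data.Nat using (ℕ; zero; suc; pred; _+_; _∸_; _≤_; _<_; z≤n; s≤s; s≤s⁻¹; z<s; s<s; s<s⁻¹; ≢-nonZero)
import Data.Nat.Properties as ℕ
open import Data.Nat.Induction using (<-wellFounded)
open import Data.Fin using (Fin; zero; suc; toℕ; fromℕ; fromℕ<; inject≤) renaming (_<_ to _<ᶠ_; _≤_ to _≤ᶠ_)
open import Data.Fin.Properties using (_≟_; _≤?_; _<?_; ≤-refl; ≤∧≢⇒<; <⇒≢; toℕ-injective; toℕ-inject; toℕ-inject≤; toℕ-fromℕ; toℕ-fromℕ<; all?; any?; ¬∀⟶∃¬-smallest)
open import Data.Fin.Subset using (Subset; inside; outside; _⊆_; _⊂_; ∣_∣; ⁅_⁆; _∪_; ⊥; ⊤) renaming (_∈_ to _∈ₛ_)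
open import Data.Fin.Subset.Properties using (_∈?_; ⊥⊆; ⊆⊤; ∈⊤; in⊆in; ⊆-refl; ⊆-antisym; ∣⊥∣≡0; ∣⊤∣≡n; ∣p∣≤n; p⊂q⇒∣p∣<∣q∣; ∪-identityˡ)
open import Data.Vec using (Vec; []; _∷_; map; lookup; tabulate)
open import Data.Vec.Properties using (map-∘; map-cong; lookup∘tabulate; []=⇒lookup; lookup⇒[]=)
open import Data.Vec.Relation.Unary.All as All using (All; []; _∷_)
import Data.Vec.Relation.Unary.All.Properties as Allₚ
open import Data.Vec.Relation.Unary.AllPairs as AllPairs using (AllPairs; []; _∷_; allPairs?)
import Data.Vec.Relation.Unary.AllPairs.Properties as AllPairsₚ
open import Data.Vec.Functional using (updateAt)
open import Data.Vec.Functional.Properties using (updateAt-updates; updateAt-minimal)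
open import Data.List using (List; []; _∷_; [_]; length; allFin; cartesianProductWith)
import Data.List as List
import Data.List.Relation.Unary.All as ListAll
open import Data.List.Relation.Unary.Any using (here; there; index)
open import Data.List.Relation.Unary.Any.Properties using (lookup-index)
open import Data.List.Membership.Propositional using (_∈_)
open import Data.List.Membership.Propositional.Properties using (∈-allFin; ∈-cartesianProductWith⁺)
open import Data.Product using (Σ; _×_; _,_; proj₁; proj₂; uncurry; ∃; ∃-syntax)
open import Function using (id; _∘_)
open import Function.Definitions using (Injective)
open import Induction.WellFounded using (Acc; acc)
open import Relation.Binary.Core using (Rel; _Preserves_⟶_)
open import Relation.Binary.Definitions using (Reflexive; tri<; tri≈; tri>)
open import Relation.Binary.Structures using (IsPartialOrder)
open import Relation.Binary.Consequences using (total∧dec⇒dec)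
import Relation.Binary.Construct.NonStrictToStrict as NonStrictToStrict
open import Relation.Binary.PropositionalEquality using (_≡_; _≢_; _≗_; refl; sym; trans; cong; subst; subst₂)
open import Relation.Nullary using (¬_; Dec; yes; no; does; proof; ¬?; contradiction)
open import Relation.Nullary.Decidable using (map′; _×-dec_; _→-dec_; dec-true; recompute; decidable-stable)
open import Relation.Nullary.Reflects using (Reflects; invert)

-- The ordered hypergraph Ramsey theorem

Increasing : ∀ {N k} → Vec (Fin N) k → Set
Increasing = AllPairs _<ᶠ_

increasing-map⁺ : ∀ {M N k} {g : Fin M → Fin N} → g Preserves _<ᶠ_ ⟶ _<ᶠ_ →
                  {v : Vec (Fin M) k} → Increasing v → Increasing (map g v)
increasing-map⁺ g↑ v↑ = AllPairsₚ.map⁺ (AllPairs.map g↑ v↑)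

increasing-suc⁻ : ∀ {N k} {w : Vec (Fin N) k} → Increasing (map suc w) → Increasing w
increasing-suc⁻ {w = []}    []         = []
increasing-suc⁻ {w = _ ∷ _} (x<w ∷ w↑) = All.map ℕ.≤-pred (Allₚ.map⁻ {f = suc} x<w) ∷ increasing-suc⁻ w↑

suc-image : ∀ {N k} (v : Vec (Fin (suc N)) k) → All (zero {n = N} <ᶠ_) v → ∃[ w ] v ≡ map suc w
suc-image []          []         = [] , refl
suc-image (suc x ∷ v) (_ ∷ 0<v) with w , refl ← suc-image v 0<v = x ∷ w , refl

data IncreasingView {N} : ∀ {k} → Vec (Fin (suc N)) k → Set where
  zero∷suc : ∀ {k} {w : Vec (Fin N) k} → Increasing w → IncreasingView (zero ∷ map suc w)
  suc      : ∀ {k} {w : Vec (Fin N) k} → Increasing w → IncreasingView (map suc w)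

increasingView : ∀ {N k} {v : Vec (Fin (suc N)) k} → Increasing v → IncreasingView v
increasingView {v = []}        []            = suc []
increasingView {v = zero ∷ v}  (0<v ∷ v↑)
  with w , refl ← suc-image v 0<v = zero∷suc (increasing-suc⁻ v↑)
increasingView {v = suc x ∷ v} (x<v ∷ v↑)
  with w , refl ← suc-image v (All.map (ℕ.<-trans z<s) x<v) =
  suc {w = x ∷ w} (increasing-suc⁻ {w = x ∷ w} (x<v ∷ v↑))

Colouring : ℕ → ℕ → ℕ → Set
Colouring N k t = (v : Vec (Fin N) k) → .(Increasing v) → Fin t

colour-cong : ∀ {N k t} (c : Colouring N k t) {v w : Vec (Fin N) k} → v ≡ w →
              .{p : Increasing v} .{q : Increasing w} → c v p ≡ c w q
colour-cong c refl = refl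

pullback : ∀ {M N k t} → Colouring N k t → (g : Fin M → Fin N) → g Preserves _<ᶠ_ ⟶ _<ᶠ_ →
           Colouring M k t
pullback c g g↑ v v↑ = c (map g v) (increasing-map⁺ g↑ v↑)

Monochromatic : ∀ {M N k t} → Colouring N k t → (g : Fin M → Fin N) →
                g Preserves _<ᶠ_ ⟶ _<ᶠ_ → Fin t → Set
Monochromatic {M} {k = k} c g g↑ i =
  (v : Vec (Fin M) k) (v↑ : Increasing v) → c (map g v) (increasing-map⁺ g↑ v↑) ≡ i

monochromatic-pullback : ∀ {L M N k t} {c : Colouring N k t} {g : Fin M → Fin N} {i}
  {g↑ : g Preserves _<ᶠ_ ⟶ _<ᶠ_} → Monochromatic c g g↑ i →
  (h : Fin L → Fin M) (h↑ : h Preserves _<ᶠ_ ⟶ _<ᶠ_) → Monochromatic (pullback c g g↑) h h↑ i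
monochromatic-pullback g-mono h h↑ v v↑ = g-mono (map h v) (increasing-map⁺ h↑ v↑)

monochromatic-∘ : ∀ {L M N k t} {c : Colouring N k t} {g : Fin M → Fin N} {h : Fin L → Fin M}
  {g↑ : g Preserves _<ᶠ_ ⟶ _<ᶠ_} {h↑ : h Preserves _<ᶠ_ ⟶ _<ᶠ_} {i} →
  Monochromatic (pullback c g g↑) h h↑ i → Monochromatic c (g ∘ h) (g↑ ∘ h↑) i
monochromatic-∘ {c = c} {g} {h} h-mono v v↑ = trans (colour-cong c (map-∘ g h v)) (h-mono v v↑)

record Copy {N k t} (c : Colouring N k t) (M : ℕ) (i : Fin t) : Set where
  field
    embed         : Fin M → Fin N
    embed↑        : embed Preserves _<ᶠ_ ⟶ _<ᶠ_
    monochromatic : Monochromatic c embed embed↑ i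

open Copy

pushforward : ∀ {M N k t} {c : Colouring N k t} {g : Fin M → Fin N} {g↑ : g Preserves _<ᶠ_ ⟶ _<ᶠ_}
  {L i} → Copy (pullback c g g↑) L i → Copy c L i
pushforward {c = c} {g} {g↑} H = record
  { embed = g ∘ embed H ; embed↑ = g↑ ∘ embed↑ H
  ; monochromatic = monochromatic-∘ {c = c} {g} {embed H} {g↑} {embed↑ H} (monochromatic H) }

restrict : ∀ {L M N k t} {c : Colouring N k t} {i} (h : Fin L → Fin M) →
           h Preserves _<ᶠ_ ⟶ _<ᶠ_ → Copy c M i → Copy c L i
restrict {c = c} h h↑ C = pushforward {c = c} {embed C} {embed↑ C} (record
  { embed = h ; embed↑ = h↑
  ; monochromatic = monochromatic-pullback {c = c} {embed C} {g↑ = embed↑ C} (monochromatic C) h h↑ })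

inject≤-strictlyMonotone : ∀ {L M} (L≤M : L ≤ M) → (λ x → inject≤ x L≤M) Preserves _<ᶠ_ ⟶ _<ᶠ_
inject≤-strictlyMonotone L≤M {x} {y} =
  subst₂ _<_ (sym (toℕ-inject≤ x L≤M)) (sym (toℕ-inject≤ y L≤M))

shrink : ∀ {L M N k t} {c : Colouring N k t} {i} → L ≤ M → Copy c M i → Copy c L i
shrink L≤M = restrict _ (inject≤-strictlyMonotone L≤M)

Arrows : ℕ → ℕ → ∀ {t} → (Fin t → ℕ) → Set
Arrows N k a = (c : Colouring N k _) → ∃[ i ] Copy c (a i) i

sum : ∀ {t} → (Fin t → ℕ) → ℕ
sum {zero}  a = 0
sum {suc t} a = a zero + sum (a ∘ suc)

≤-sum : ∀ {t} (a : Fin t → ℕ) i → a i ≤ sum a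
≤-sum a zero    = ℕ.m≤m+n (a zero) _
≤-sum a (suc i) = ℕ.≤-trans (≤-sum (a ∘ suc) i) (ℕ.m≤n+m _ (a zero))

sum-updateAt-pred : ∀ {t} (a : Fin t → ℕ) j → a j ≢ 0 → sum (updateAt a j pred) < sum a
sum-updateAt-pred a zero    aj≢0 =
  ℕ.+-monoˡ-< (sum (a ∘ suc)) (ℕ.m≤pred[n]⇒suc[m]≤n {{≢-nonZero aj≢0}} ℕ.≤-refl)
sum-updateAt-pred a (suc j) aj≢0 = ℕ.+-monoʳ-< (a zero) (sum-updateAt-pred (a ∘ suc) j aj≢0)

arrows-zero : ∀ {t} (a : Fin t → ℕ) → Arrows (sum a) 0 a
arrows-zero a c =
  i , shrink (≤-sum a i) (record { embed = id ; embed↑ = id ; monochromatic = λ { [] [] → refl } })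
  where
  i = c [] []

arrows-trivial : ∀ {N k t} {a : Fin t → ℕ} {j} → a j ≡ 0 → Arrows N (suc k) a
arrows-trivial {j = j} aj≡0 c = j , shrink (ℕ.≤-reflexive aj≡0)
  (record { embed = λ () ; embed↑ = λ { {()} } ; monochromatic = λ { (() ∷ _) _ } })

suc↑ : ∀ {N} → suc {N} Preserves _<ᶠ_ ⟶ _<ᶠ_
suc↑ = s<s

increasing-zero∷suc : ∀ {N k} {w : Vec (Fin N) k} → Increasing w → Increasing (zero ∷ map suc w)
increasing-zero∷suc {w = w} w↑ = Allₚ.map⁺ (All.universal (λ _ → z<s) w) ∷ increasing-map⁺ suc↑ w↑

link : ∀ {N k t} → Colouring (suc N) (suc k) t → Colouring N k t
link c w w↑ = c (zero ∷ map suc w) (increasing-zero∷suc w↑)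

module _ {N k t} (c : Colouring (suc N) (suc k) t) {M j} (C : Copy (link c) M j) where

  cone : Fin (suc M) → Fin (suc N)
  cone zero    = zero
  cone (suc x) = suc (embed C x)

  cone↑ : cone Preserves _<ᶠ_ ⟶ _<ᶠ_
  cone↑ {zero}  {suc _} _   = z<s
  cone↑ {suc _} {suc _} x<y = s<s (embed↑ C (s<s⁻¹ x<y))

  map-cone-suc : ∀ {n} (w : Vec (Fin M) n) → map cone (map suc w) ≡ map suc (map (embed C) w)
  map-cone-suc w = trans (sym (map-∘ cone suc w)) (map-∘ suc (embed C) w)

  cone-copy : Monochromatic (pullback c suc suc↑) (embed C) (embed↑ C) j → Copy c (suc M) j
  cone-copy off-apex = record { embed = cone ; embed↑ = cone↑ ; monochromatic = cone-monochromatic }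
    where
    cone-monochromatic : Monochromatic c cone cone↑ j
    cone-monochromatic v v↑ with increasingView v↑
    ... | zero∷suc {w = w} w↑ =
      trans (colour-cong c (cong (zero ∷_) (map-cone-suc w))) (monochromatic C w w↑)
    ... | suc {w = w} w↑ = trans (colour-cong c (map-cone-suc w)) (off-apex w w↑)

n≤1+pred[n] : ∀ n → n ≤ suc (pred n)
n≤1+pred[n] zero    = z≤n
n≤1+pred[n] (suc n) = ℕ.≤-refl

-- Colour the link of 0 to find a b_j-set C monochromatic in some colour j, then colour the
-- (k+1)-sets inside C: a copy in a colour l ≢ j is already good, and in colour j the cone
-- over it with apex 0 is.
arrows-suc : ∀ {N k t} {a b : Fin t → ℕ} → Arrows N k b →
             (∀ j → Arrows (b j) (suc k) (updateAt a j pred)) → Arrows (suc N) (suc k) a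
arrows-suc {a = a} N⟶b b⟶a c with N⟶b (link c)
... | j , C with b⟶a j (pullback (pullback c suc suc↑) (embed C) (embed↑ C))
... | l , D with l ≟ j
... | no l≢j  = l , shrink (ℕ.≤-reflexive (sym (updateAt-minimal l j a l≢j)))
  (pushforward {c = c} {suc} {suc↑} (pushforward {c = pullback c suc suc↑} {embed C} {embed↑ C} D))
... | yes refl = l , shrink a≤ (cone-copy c (restrict (embed D) (embed↑ D) C)
  (monochromatic-∘ {c = pullback c suc suc↑} {embed C} {embed D} {embed↑ C} {embed↑ D} (monochromatic D)))
  where
  a≤ : a l ≤ suc (updateAt a l pred l)
  a≤ = ℕ.≤-trans (n≤1+pred[n] (a l)) (ℕ.≤-reflexive (cong suc (sym (updateAt-updates l a))))

ramsey : ∀ k {t} (a : Fin t → ℕ) → ∃[ N ] Arrows N k a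
ramsey zero    a = sum a , arrows-zero a
ramsey (suc k) a = by-sum a (<-wellFounded (sum a))
  where
  by-sum : ∀ {t} (a : Fin t → ℕ) → Acc _<_ (sum a) → ∃[ N ] Arrows N (suc k) a
  by-sum {t} a (acc smaller) with any? (λ j → a j ℕ.≟ 0)
  ... | yes (j , aj≡0) = 0 , arrows-trivial aj≡0
  ... | no a≢0 = suc (proj₁ (ramsey k b)) , arrows-suc (proj₂ (ramsey k b)) (proj₂ ∘ decrement)
    where
    decrement : ∀ j → ∃[ N ] Arrows N (suc k) (updateAt a j pred)
    decrement j = by-sum _ (smaller (sum-updateAt-pred a j (λ aj≡0 → a≢0 (j , aj≡0))))
    b : Fin t → ℕ
    b = proj₁ ∘ decrement

-- Copies of totally ordered pographs

module _ {A : Set} {R : Rel A 0ℓ} where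

  isChain⇒allPairs : ∀ {k} {v : Vec A k} → IsChain R v → AllPairs (Strict R) v
  isChain⇒allPairs {v = []}    _       = []
  isChain⇒allPairs {v = _ ∷ _} v-chain =
    Allₚ.lookup⁻ (λ j → v-chain zero (suc j) z<s)
    ∷ isChain⇒allPairs (λ i j i<j → v-chain (suc i) (suc j) (s<s i<j))

  allPairs⇒isChain : ∀ {k} {v : Vec A k} → AllPairs (Strict R) v → IsChain R v
  allPairs⇒isChain (x≺v ∷ _)  zero    (suc j) _   = Allₚ.lookup⁺ x≺v j
  allPairs⇒isChain (_   ∷ v↑) (suc i) (suc j) i<j = allPairs⇒isChain v↑ i j (s<s⁻¹ i<j)

  kchain-cong : ∀ {k} {B : Set} (c : KChain R k → B) {v w : Vec A k} → v ≡ w →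
                .{p : IsChain R v} .{q : IsChain R w} → c (chain v p) ≡ c (chain w q)
  kchain-cong c refl = refl

isChain-map : ∀ {A B : Set} {R : Rel A 0ℓ} {S : Rel B 0ℓ} {f : A → B} → f Preserves Strict R ⟶ Strict S →
              ∀ {k} {v : Vec A k} → IsChain R v → IsChain S (map f v)
isChain-map {R = R} {S} {f} f↑ {v = v} v-chain =
  allPairs⇒isChain {R = S} {v = map f v}
    (AllPairsₚ.map⁺ (AllPairs.map f↑ (isChain⇒allPairs {R = R} v-chain)))

injective∧monotone⇒strict : ∀ {A B : Set} {R : Rel A 0ℓ} {S : Rel B 0ℓ} {f : A → B} →
  (∀ x y → R x y → S (f x) (f y)) → Injective _≡_ _≡_ f → f Preserves Strict R ⟶ Strict S
injective∧monotone⇒strict f-mono f-inj (x≤y , x≢y) = f-mono _ _ x≤y , x≢y ∘ f-inj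

strict⇒monotone : ∀ {n} {B : Set} {R : Rel (Fin n) 0ℓ} {S : Rel B 0ℓ} {f : Fin n → B} → Reflexive S →
  f Preserves Strict R ⟶ Strict S → ∀ x y → R x y → S (f x) (f y)
strict⇒monotone S-refl f↑ x y x≤y with x ≟ y
... | yes refl = S-refl
... | no x≢y   = proj₁ (f↑ (x≤y , x≢y))

<⇒strict : ∀ {n} {x y : Fin n} → x <ᶠ y → Strict _≤ᶠ_ x y
<⇒strict x<y = ℕ.<⇒≤ x<y , <⇒≢ x<y

strict⇒< : ∀ {n} {x y : Fin n} → Strict _≤ᶠ_ x y → x <ᶠ y
strict⇒< = uncurry ≤∧≢⇒<

strictlyMonotone⇒strict : ∀ {m n} {g : Fin m → Fin n} → g Preserves _<ᶠ_ ⟶ _<ᶠ_ →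
                          g Preserves Strict _≤ᶠ_ ⟶ Strict _≤ᶠ_
strictlyMonotone⇒strict g↑ = <⇒strict ∘ g↑ ∘ strict⇒<

increasing⇒isChain : ∀ {n k} {v : Vec (Fin n) k} → Increasing v → IsChain _≤ᶠ_ v
increasing⇒isChain = allPairs⇒isChain ∘ AllPairs.map <⇒strict

isChain⇒increasing : ∀ {n k} {v : Vec (Fin n) k} → IsChain _≤ᶠ_ v → Increasing v
isChain⇒increasing = AllPairs.map strict⇒< ∘ isChain⇒allPairs

module TotallyOrderedPograph {k} (H : Pograph k) (total : TotallyOrdered H) where
  open Pograph H
  open IsPartialOrder isPartialOrder using (antisym; reflexive)
  open NonStrictToStrict _≡_ _≼_ using (<-trichotomous; <-trans; <-irrefl; <-decidable)

  _≼?_ = total∧dec⇒dec reflexive antisym total _≟_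

  strict⇒injective : ∀ {B : Set} {S : Rel B 0ℓ} {f : Fin n → B} →
                     f Preserves Strict _≼_ ⟶ Strict S → Injective _≡_ _≡_ f
  strict⇒injective f↑ {x} {y} fx≡fy with <-trichotomous sym _≟_ antisym total x y
  ... | tri< x≺y _ _ = contradiction fx≡fy (proj₂ (f↑ x≺y))
  ... | tri≈ _ x≡y _ = x≡y
  ... | tri> _ _ y≺x = contradiction (sym fx≡fy) (proj₂ (f↑ y≺x))

  _≺?_ = <-decidable _≟_ _≼?_

  below : Fin n → Subset n
  below x = tabulate (λ y → does (y ≺? x))

  ∈-below⁺ : ∀ {x y} → Strict _≼_ y x → y ∈ₛ below x
  ∈-below⁺ {x} {y} y≺x = lookup⇒[]= y (below x) (trans (lookup∘tabulate _ y) (dec-true (y ≺? x) y≺x))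

  ∈-below⁻ : ∀ {x y} → y ∈ₛ below x → Strict _≼_ y x
  ∈-below⁻ {x} {y} y∈ =
    invert (subst (Reflects _) (trans (sym (lookup∘tabulate _ y)) ([]=⇒lookup y∈)) (proof (y ≺? x)))

  ∉-below : ∀ x → ¬ x ∈ₛ below x
  ∉-below x x∈ = <-irrefl refl (∈-below⁻ x∈)

  strict⇒copy : ∀ {A : Set} {_≤'_ : Rel A 0ℓ} {t} {c : KChain _≤'_ k → Fin t} {i} → Reflexive _≤'_ →
    (f : Fin n → A) → f Preserves Strict _≼_ ⟶ Strict _≤'_ →
    (∀ {e} → e ∈ edges → (p : IsChain _≤'_ (map f e)) → c (chain (map f e) p) ≡ i) → HasCopy _≤'_ c H i
  strict⇒copy {_≤'_ = _≤'_} ≤'-refl f f↑ colours-edges =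
    f , strict⇒injective {S = _≤'_} {f} f↑ , strict⇒monotone {S = _≤'_} {f} ≤'-refl f↑ , colours-edges

  rank : Fin n → Fin n
  rank x = fromℕ< (subst (∣ below x ∣ <_) (∣⊤∣≡n n) (p⊂q⇒∣p∣<∣q∣ (⊆⊤ , x , ∈⊤ , ∉-below x)))

  rank↑ : rank Preserves Strict _≼_ ⟶ _<ᶠ_
  rank↑ {x} {y} x≺y = subst₂ _<_ (sym (toℕ-fromℕ< _)) (sym (toℕ-fromℕ< _)) (p⊂q⇒∣p∣<∣q∣ below-⊂)
    where
    below-⊂ : below x ⊂ below y
    below-⊂ = (λ z∈ → ∈-below⁺ (<-trans isPartialOrder (∈-below⁻ z∈) x≺y)) , x , ∈-below⁺ x≺y , ∉-below x

crProp-exists : ∀ {k t} (G : Fin t → Pograph k) → (∀ i → TotallyOrdered (G i)) → Σ ℕ (CRProp G)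
crProp-exists {k} G total with N , N⟶n ← ramsey k (Pograph.n ∘ G) =
  N , λ c → copy c (N⟶n (λ v v↑ → c (chain v (increasing⇒isChain v↑))))
  where
  copy : ∀ c → ∃[ i ] Copy (λ v v↑ → c (chain v (increasing⇒isChain v↑))) (Pograph.n (G i)) i →
         ∃[ i ] HasCopy _≤ᶠ_ c (G i) i
  copy c (i , C) =
    i , strict⇒copy {c = c} ≤-refl (embed C ∘ rank) (<⇒strict ∘ embed↑ C ∘ rank↑) colours-edges
    where
    open Pograph (G i)
    open TotallyOrderedPograph (G i) (total i)
    colours-edges : ∀ {e} → e ∈ edges → (p : IsChain _≤ᶠ_ (map (embed C ∘ rank) e)) →
                    c (chain (map (embed C ∘ rank) e) p) ≡ i
    colours-edges {e} e∈ _ = trans (kchain-cong c (map-∘ (embed C) rank e))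
      (monochromatic C (map rank e) (isChain⇒increasing
        (isChain-map {R = _≼_} {_≤ᶠ_} {rank} (<⇒strict ∘ rank↑) {v = e} (edgesAreChains e∈))))

module _ {k t} (G : Fin t → Pograph k) (total : ∀ i → TotallyOrdered (G i))
         {A B : Set} (_≤A_ : Rel A 0ℓ) (_≤B_ : Rel B 0ℓ) (≤B-refl : Reflexive _≤B_)
         (r : A → B) (r↑ : r Preserves Strict _≤A_ ⟶ Strict _≤B_) where

  ramseyFor-transfer : RamseyFor _≤A_ G → RamseyFor _≤B_ G
  ramseyFor-transfer A⟶G c
    with A⟶G (λ (chain v p) → c (chain (map r v) (isChain-map {R = _≤A_} {_≤B_} {r} r↑ {v = v} p)))
  ... | i , f , f-inj , f-mono , f-edges =
    i , strict⇒copy {c = c} ≤B-refl (r ∘ f) (r↑ ∘ f↑) colours-edges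
    where
    open Pograph (G i)
    open TotallyOrderedPograph (G i) (total i)
    f↑ : f Preserves Strict _≼_ ⟶ Strict _≤A_
    f↑ = injective∧monotone⇒strict {R = _≼_} {_≤A_} {f} f-mono f-inj
    colours-edges : ∀ {e} → e ∈ edges → (p : IsChain _≤B_ (map (r ∘ f) e)) →
                    c (chain (map (r ∘ f) e) p) ≡ i
    colours-edges {e} e∈ _ = trans (kchain-cong c (map-∘ r f e))
      (f-edges e∈ (isChain-map {R = _≼_} {_≤A_} {f} f↑ {v = e} (edgesAreChains e∈)))

-- Chains, Boolean lattices and k-subsets

segment : ∀ {m} → Fin (suc m) → Subset m
segment zero            = ⊥
segment {suc m} (suc j) = inside ∷ segment j

∣segment∣ : ∀ {m} (j : Fin (suc m)) → ∣ segment j ∣ ≡ toℕ j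
∣segment∣ {m} zero        = ∣⊥∣≡0 m
∣segment∣ {suc m} (suc j) = cong suc (∣segment∣ j)

segment-mono : ∀ {m} {j j' : Fin (suc m)} → j ≤ᶠ j' → segment j ⊆ segment j'
segment-mono {j = zero}                     _     = ⊥⊆
segment-mono {suc m} {j = suc j} {suc j'} j≤j' = in⊆in (segment-mono (s≤s⁻¹ j≤j'))

segment-strict : ∀ {m} → segment {m} Preserves Strict _≤ᶠ_ ⟶ Strict _⊆_
segment-strict {x = j} {y = j'} (j≤j' , j≢j') =
  segment-mono j≤j' ,
  λ eq → j≢j' (toℕ-injective (trans (sym (∣segment∣ j)) (trans (cong ∣_∣ eq) (∣segment∣ j'))))

⊆∧≢⇒⊂ : ∀ {m} {p q : Subset m} → p ⊆ q → p ≢ q → p ⊂ q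
⊆∧≢⇒⊂ {p = p} {q} p⊆q p≢q with any? (λ x → x ∈? q ×-dec ¬? (x ∈? p))
... | yes q∖p-nonempty = p⊆q , q∖p-nonempty
... | no q∖p-empty     = contradiction (⊆-antisym p⊆q q⊆p) p≢q
  where
  q⊆p : q ⊆ p
  q⊆p {x} x∈q = decidable-stable (x ∈? p) (λ x∉p → q∖p-empty (x , x∈q , x∉p))

cardinality : ∀ {m} → Subset m → Fin (suc m)
cardinality p = fromℕ< (s≤s (∣p∣≤n p))

cardinality-strict : ∀ {m} → cardinality {m} Preserves Strict _⊆_ ⟶ Strict _≤ᶠ_
cardinality-strict (p⊆q , p≢q) =
  <⇒strict (subst₂ _<_ (sym (toℕ-fromℕ< _)) (sym (toℕ-fromℕ< _)) (p⊂q⇒∣p∣<∣q∣ (⊆∧≢⇒⊂ p⊆q p≢q)))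

module _ {k t} (G : Fin t → Pograph k) (total : ∀ i → TotallyOrdered (G i)) where

  crProp-mono : ∀ {m m'} → m ≤ m' → CRProp G m → CRProp G m'
  crProp-mono m≤m' = ramseyFor-transfer G total _≤ᶠ_ _≤ᶠ_ ≤-refl _
    (strictlyMonotone⇒strict (inject≤-strictlyMonotone m≤m'))

  crProp-suc⇒brProp : ∀ {m} → CRProp G (suc m) → BRProp G m
  crProp-suc⇒brProp = ramseyFor-transfer G total _≤ᶠ_ _⊆_ (λ {p} {x} → ⊆-refl {x = p} {x}) segment segment-strict

  brProp⇒crProp-suc : ∀ {m} → BRProp G m → CRProp G (suc m)
  brProp⇒crProp-suc = ramseyFor-transfer G total _⊆_ _≤ᶠ_ ≤-refl cardinality cardinality-strict

image-suc : ∀ {m k} (w : Vec (Fin m) k) → image (map suc w) ≡ outside ∷ image w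
image-suc []      = refl
image-suc (x ∷ w) = cong (⁅ suc x ⁆ ∪_) (image-suc w)

image-zero∷suc : ∀ {m k} (w : Vec (Fin m) k) → image (zero ∷ map suc w) ≡ inside ∷ image w
image-zero∷suc w = trans (cong (⁅ zero ⁆ ∪_) (image-suc w)) (cong (inside ∷_) (∪-identityˡ (image w)))

∣image∣ : ∀ {m k} {v : Vec (Fin m) k} → Increasing v → ∣ image v ∣ ≡ k
∣image∣ {zero}  {v = []}    _  = refl
∣image∣ {zero}  {v = () ∷ _}
∣image∣ {suc m} v↑ with increasingView v↑
... | zero∷suc {w = w} w↑ = trans (cong ∣_∣ (image-zero∷suc w)) (cong suc (∣image∣ w↑))
... | suc {w = w} w↑      = trans (cong ∣_∣ (image-suc w)) (∣image∣ w↑)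

enumerate : ∀ {m} (s : Subset m) k → .(∣ s ∣ ≡ k) → Vec (Fin m) k
enumerate []            zero    _  = []
enumerate (inside ∷ s)  (suc k) ∣s∣≡k = zero ∷ map suc (enumerate s k (ℕ.suc-injective ∣s∣≡k))
enumerate (outside ∷ s) k       ∣s∣≡k = map suc (enumerate s k ∣s∣≡k)
enumerate []            (suc k) ()
enumerate (inside ∷ s)  zero    ()

enumerate-increasing : ∀ {m} (s : Subset m) k .(∣s∣≡k : ∣ s ∣ ≡ k) → Increasing (enumerate s k ∣s∣≡k)
enumerate-increasing []            zero    _     = []
enumerate-increasing (inside ∷ s)  (suc k) ∣s∣≡k = increasing-zero∷suc (enumerate-increasing s k _)
enumerate-increasing (outside ∷ s) k       ∣s∣≡k = increasing-map⁺ suc↑ (enumerate-increasing s k ∣s∣≡k)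
enumerate-increasing []            (suc k) ()
enumerate-increasing (inside ∷ s)  zero    ()

enumerate-cong : ∀ {m k} {s s' : Subset m} (s≡s' : s ≡ s') .(∣s∣≡k : ∣ s ∣ ≡ k) →
                 enumerate s k ∣s∣≡k ≡ enumerate s' k (trans (cong ∣_∣ (sym s≡s')) ∣s∣≡k)
enumerate-cong refl _ = refl

enumerate-image : ∀ {m k} {v : Vec (Fin m) k} → Increasing v → .(e : ∣ image v ∣ ≡ k) →
                  enumerate (image v) k e ≡ v
enumerate-image {zero}  {v = []}     _ _ = refl
enumerate-image {zero}  {v = () ∷ _}
enumerate-image {suc m} v↑ e with increasingView v↑
... | zero∷suc {w = w} w↑ =
  trans (enumerate-cong (image-zero∷suc w) e) (cong (λ u → zero ∷ map suc u) (enumerate-image w↑ _))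
... | suc {w = w} w↑      = trans (enumerate-cong (image-suc w) e) (cong (map suc) (enumerate-image w↑ _))

module _ {k t} (G : Fin t → Pograph k) where

  crProp⇒orProp : ∀ {m} → CRProp G m → ORProp G m
  crProp⇒orProp CR c with CR (λ (chain v p) → c (ksubset (image v) (∣image∣ (isChain⇒increasing {v = v} p))))
  ... | i , f , f-inj , f-mono , f-edges =
    i , f , (λ _ _ → strict⇒< ∘ f↑) ,
    λ {e} e∈ _ → f-edges e∈ (isChain-map {R = _≼_} {_≤ᶠ_} {f} f↑ {v = e} (edgesAreChains e∈))
    where
    open Pograph (G i)
    f↑ : f Preserves Strict _≼_ ⟶ Strict _≤ᶠ_
    f↑ = injective∧monotone⇒strict {R = _≼_} {_≤ᶠ_} {f} f-mono f-inj

  orProp⇒crProp : (∀ i → TotallyOrdered (G i)) → ∀ {m} → ORProp G m → CRProp G m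
  orProp⇒crProp total OR c
    with OR (λ (ksubset s p) → c (chain (enumerate s k p) (increasing⇒isChain (enumerate-increasing s k p))))
  ... | i , f , f↑ , f-edges =
    i , strict⇒copy {c = c} ≤-refl f (λ x≺y → <⇒strict (f↑ _ _ x≺y)) colours-edges
    where
    open Pograph (G i)
    open TotallyOrderedPograph (G i) (total i)
    colours-edges : ∀ {e} → e ∈ edges → (p : IsChain _≤ᶠ_ (map f e)) → c (chain (map f e) p) ≡ i
    colours-edges {e} e∈ p = trans (kchain-cong c (sym (enumerate-image fe↑ _))) (f-edges e∈ (∣image∣ fe↑))
      where fe↑ = isChain⇒increasing {v = map f e} p

-- Deciding CRProp

all-vectors? : ∀ {t} n {P : Vec (Fin t) n → Set} → (∀ v → Dec (P v)) → Dec (∀ v → P v)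
all-vectors? zero    P? = map′ (λ p → λ { [] → p }) (λ ∀P → ∀P []) (P? [])
all-vectors? (suc n) P? =
  map′ (λ ∀P → λ { (x ∷ v) → ∀P x v }) (λ ∀P x v → ∀P (x ∷ v))
       (all? λ x → all-vectors? n (P? ∘ (x ∷_)))

any-vector? : ∀ {t} n {P : Vec (Fin t) n → Set} → (∀ v → Dec (P v)) → Dec (∃ P)
any-vector? zero    P? = map′ ([] ,_) (λ { ([] , p) → p }) (P? [])
any-vector? (suc n) P? =
  map′ (λ { (x , v , p) → x ∷ v , p }) (λ { (x ∷ v , p) → x , v , p })
       (any? λ x → any-vector? n (P? ∘ (x ∷_)))

module FiniteFunctions {A : Set} (xs : List A) (complete : ∀ a → a ∈ xs) {t} {P : (A → Fin t) → Set}
                       (P-resp : ∀ {f g} → f ≗ g → P f → P g) (P? : ∀ f → Dec (P f)) where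

  decode : Vec (Fin t) (length xs) → A → Fin t
  decode table a = lookup table (index (complete a))

  encode : (A → Fin t) → Vec (Fin t) (length xs)
  encode f = tabulate (f ∘ List.lookup xs)

  decode-encode : ∀ f → decode (encode f) ≗ f
  decode-encode f a = trans (lookup∘tabulate _ (index (complete a))) (cong f (sym (lookup-index (complete a))))

  all-functions? : Dec (∀ f → P f)
  all-functions? = map′ (λ ∀P f → P-resp (decode-encode f) (∀P (encode f))) (λ ∀P → ∀P ∘ decode)
                        (all-vectors? _ (P? ∘ decode))

  any-function? : Dec (∃ P)
  any-function? = map′ (λ (table , p) → decode table , p)
                       (λ (f , p) → encode f , P-resp (sym ∘ decode-encode f) p)
                       (any-vector? _ (P? ∘ decode))

vectors : ∀ m k → List (Vec (Fin m) k)
vectors m zero    = [ [] ]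
vectors m (suc k) = cartesianProductWith _∷_ (allFin m) (vectors m k)

∈-vectors : ∀ {m k} (v : Vec (Fin m) k) → v ∈ vectors m k
∈-vectors []      = here refl
∈-vectors (x ∷ v) = ∈-cartesianProductWith⁺ _∷_ (∈-allFin x) (∈-vectors v)

isChain? : ∀ {m k} (v : Vec (Fin m) k) → Dec (IsChain _≤ᶠ_ v)
isChain? v = map′ increasing⇒isChain (isChain⇒increasing {v = v}) (allPairs? _<?_ v)

kchains : ∀ {m k} → List (Vec (Fin m) k) → List (KChain _≤ᶠ_ k)
kchains []       = []
kchains (v ∷ vs) with isChain? v
... | yes p = chain v p ∷ kchains vs
... | no _  = kchains vs

∈-kchains : ∀ {m k} {vs} {v : Vec (Fin m) k} → v ∈ vs → .(p : IsChain _≤ᶠ_ v) → chain v p ∈ kchains vs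
∈-kchains {vs = v ∷ _} (here refl) p with isChain? v
... | yes _ = here refl
... | no ¬p = contradiction (recompute (isChain? v) p) ¬p
∈-kchains {vs = w ∷ _} (there v∈) p with isChain? w
... | yes _ = there (∈-kchains v∈ p)
... | no _  = ∈-kchains v∈ p

module _ {k t} (G : Fin t → Pograph k) (total : ∀ i → TotallyOrdered (G i)) where

  hasCopy? : ∀ {m} (c : KChain _≤ᶠ_ k → Fin t) i → Dec (HasCopy {A = Fin m} _≤ᶠ_ c (G i) i)
  hasCopy? {m} c i = FiniteFunctions.any-function? (allFin n) ∈-allFin isCopy-resp isCopy?
    where
    open Pograph (G i)
    open TotallyOrderedPograph (G i) (total i) using (_≼?_)

    IsCopy : (Fin n → Fin m) → Set
    IsCopy f = Injective _≡_ _≡_ f × (∀ x y → x ≼ y → f x ≤ᶠ f y)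
             × (∀ {e} → e ∈ edges → (p : IsChain _≤ᶠ_ (map f e)) → c (chain (map f e) p) ≡ i)

    isCopy? : ∀ f → Dec (IsCopy f)
    isCopy? f = injective? ×-dec monotone? ×-dec colours-edges?
      where
      injective? = map′ (λ inj {x} {y} → inj x y) (λ inj x y → inj)
                        (all? λ x → all? λ y → (f x ≟ f y) →-dec (x ≟ y))
      monotone?  = all? λ x → all? λ y → (x ≼? y) →-dec (f x ≤? f y)
      colours-edge? : ∀ e → Dec ((p : IsChain _≤ᶠ_ (map f e)) → c (chain (map f e) p) ≡ i)
      colours-edge? e with isChain? (map f e)
      ... | yes p = map′ (λ eq _ → eq) (λ h → h p) (c (chain (map f e) p) ≟ i)
      ... | no ¬p = yes (λ p → contradiction p ¬p)
      colours-edges? = map′ (λ all {e} → ListAll.lookup all) ListAll.tabulate (ListAll.all? colours-edge? edges)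

    isCopy-resp : ∀ {f g} → f ≗ g → IsCopy f → IsCopy g
    isCopy-resp {f} {g} f≗g (f-inj , f-mono , f-edges) =
      (λ {x} {y} gx≡gy → f-inj (trans (f≗g x) (trans gx≡gy (sym (f≗g y))))) ,
      (λ x y x≼y → subst₂ _≤ᶠ_ (f≗g x) (f≗g y) (f-mono x y x≼y)) ,
      λ {e} e∈ p → trans (kchain-cong c (sym (map-cong f≗g e)))
                         (f-edges e∈ (subst (IsChain _≤ᶠ_) (sym (map-cong f≗g e)) p))

  crProp? : ∀ m → Dec (CRProp G m)
  crProp? m = FiniteFunctions.all-functions? (kchains (vectors m k)) (λ (chain v p) → ∈-kchains (∈-vectors v) p)
    (λ c≗c' (i , f , f-inj , f-mono , f-edges) →
       i , f , f-inj , f-mono , λ e∈ p → trans (sym (c≗c' _)) (f-edges e∈ p))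
    (λ c → any? (hasCopy? c))

least : ∀ {P : ℕ → Set} → (∀ n → Dec (P n)) → ∀ {N} → P N → Σ ℕ (IsLeast P)
least {P} P? {N} pN
  with ¬∀⟶∃¬-smallest (suc N) (λ i → ¬ P (toℕ i)) (¬? ∘ P? ∘ toℕ)
                       (λ ∀¬P → ∀¬P (fromℕ N) (subst P (sym (toℕ-fromℕ N)) pN))
... | i , ¬¬Pi , ¬P-below-i = toℕ i , decidable-stable (P? _) ¬¬Pi , minimal
  where
  minimal : ∀ M → P M → toℕ i ≤ M
  minimal M pM with M ℕ.<? toℕ i
  ... | no M≮i  = ℕ.≮⇒≥ M≮i
  ... | yes M<i = contradiction (subst P (sym (trans (toℕ-inject j) (toℕ-fromℕ< M<i))) pM) (¬P-below-i j)
    where j = fromℕ< M<i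

proposition3p2 : ∀ {k t : ℕ} (G : Fin t → Pograph k) →
    (∀ i → TotallyOrdered (G i)) →
    Σ ℕ λ M → IsLeast (CRProp G) M × IsLeast (ORProp G) M
    × IsLeast (BRProp G) (M ∸ 1)
proposition3p2 G total = from-least (least (crProp? G total) (proj₂ (crProp-exists G total)))
  where
  from-least : Σ ℕ (IsLeast (CRProp G)) →
    Σ ℕ λ M → IsLeast (CRProp G) M × IsLeast (ORProp G) M × IsLeast (BRProp G) (M ∸ 1)
  from-least (M , CR-M , CR-least) =
    M , (CR-M , CR-least)
      , (crProp⇒orProp G CR-M , λ M' → CR-least M' ∘ orProp⇒crProp G total)
      , (crProp-suc⇒brProp G total (crProp-mono G total (ℕ.m≤n+m∸n M 1) CR-M)
        , λ M' → ℕ.∸-monoˡ-≤ 1 ∘ CR-least (suc M') ∘ brProp⇒crProp-suc G total)
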